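{- Let $T, U \in \mathsf{sylv}_n$ be standard elements each having $n$ nodes. Then there is a sequence $T = T_0, T_1, \ldots, T_n = U$ of elements of $\mathsf{sylv}_n$ with $T_h \sim T_{h+1}$ for $h = 0, \ldots, n-1$.
   Context: $\mathcal{A}_n = \{1<2<\cdots<n\}$. The sylvester monoid of rank $n$, $\mathsf{sylv}_n$, is the monoid presented by $\langle \mathcal{A}_n \mid (cavb, acvb)\text{ for all } a \leq b < c \text{ in } \mathcal{A}_n,\ v \in \mathcal{A}_n^*\rangle$; its elements correspond to right strict binary search trees (obtained by inserting the symbols of a representing word, right to left, as leaves, where each node's label is $\geq$ all labels in its left subtree and $<$ all labels in its right subtree). A standard element with $n$ nodes is one whose tree has exactly one node labelled by each symbol of $\{1,\ldots,n\}$ (equivalently, represented by a word containing each of $1,\ldots,n$ exactly once). For $s,t \in \mathsf{sylv}_n$, $s \sim t$ means there exist $x, y \in \mathsf{sylv}_n$ with $s = xy$ and $t = yx$. -}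

module Defs where

open import Data.Nat using (ℕ; suc)
open import Data.Fin using (Fin; zero; suc; fromℕ; inject₁) renaming (_≤_ to _≤ᶠ_; _<_ to _<ᶠ_)
open import Data.List using (List; []; _∷_; _++_; [_])
open import Data.List using () renaming (allFin to allFinL)
open import Data.List.Relation.Binary.Permutation.Propositional using (_↭_)
open import Data.Product using (Σ; _×_; ∃-syntax)
open import Relation.Binary.Construct.Closure.Equivalence using (EqClosure)

-- The alphabet A_n = {1 < 2 < ... < n} is modelled by Fin n (symbol i+1 ↦ i),
-- with its natural order.
Word : ℕ → Set
Word n = List (Fin n)

data SylvStep {n : ℕ} : Word n → Word n → Set where
  step : (u w v : Word n) (a b c : Fin n) → a ≤ᶠ b → b <ᶠ c →
         SylvStep (u ++ (c ∷ a ∷ (v ++ [ b ])) ++ w)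
                  (u ++ (a ∷ c ∷ (v ++ [ b ])) ++ w)

-- The congruence generated by the defining relations of sylv_n:
-- equivalence closure of one-step rewrites in context.
-- Two words represent the same element of sylv_n iff  u ≈sylv w.
_≈sylv_ : {n : ℕ} → Word n → Word n → Set
_≈sylv_ {n} = EqClosure (SylvStep {n})

-- An element (represented by the word t) is standard with n nodes:
-- it is represented by a word containing each symbol of A_n exactly once.
Standard : (n : ℕ) → Word n → Set
Standard n t = ∃[ w ] (w ≈sylv t × w ↭ allFinL n)

_∼_ : {n : ℕ} → Word n → Word n → Set
s ∼ t = ∃[ x ] ∃[ y ] ((s ≈sylv (x ++ y)) × (t ≈sylv (y ++ x)))

module Submission where

open import Defs
open import Data.Nat using (ℕ; suc)
open import Data.Fin using (Fin; zero; suc; fromℕ; inject₁)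
open import Data.Product using (Σ; _×_; ∃-syntax)

import Data.Nat as ℕ
open import Data.Nat using (_<_; _≤_; _<?_; _≤?_; _≟_; _+_; z≤n; s≤s)
import Data.Nat.Properties as ℕP
open import Data.Fin using (toℕ; fromℕ<)
open import Data.Fin.Properties using (toℕ-fromℕ<; toℕ<n)
open import Data.List using (List; []; _∷_; _++_; [_]; filter; allFin; tabulate)
open import Data.List.Properties
  using (++-assoc; ++-identityʳ; filter-++; filter-accept; filter-reject; filter-all; filter-none; ++-conicalˡ; ++-conicalʳ; ∷-injective)
open import Data.List.Relation.Unary.All as All using (All; []; _∷_)
open import Data.List.Relation.Unary.All.Properties using (all-filter; ++⁺; ++⁻ˡ; ++⁻ʳ)
open import Data.List.Relation.Binary.Permutation.Propositional using (_↭_; ↭-sym; ↭-trans)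
open import Data.List.Relation.Binary.Permutation.Propositional.Properties
  using (filter-↭; ↭-singleton-inv; ↭-empty-inv; ∈-resp-↭; ++⁺ˡ; ++⁺ʳ; ++-comm)
import Data.List.Relation.Binary.Permutation.Propositional as Perm
open import Data.List.Membership.Propositional.Properties using (∈-∃++; ∈-allFin)
open import Data.Product using (_,_)
open import Data.Sum using (_⊎_; inj₁; inj₂)
open import Relation.Binary.Definitions using (tri<; tri≈; tri>)
open import Relation.Binary.PropositionalEquality using (_≡_; _≢_; refl; sym; trans; cong; cong₂; subst; subst₂; module ≡-Reasoning)
open import Relation.Nullary using (¬_; yes; no)
open import Relation.Binary.Construct.Closure.ReflexiveTransitive using (ε; _◅_; _◅◅_)
open import Relation.Binary.Construct.Closure.Symmetric using (fwd; bwd)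
import Relation.Binary.Construct.Closure.Equivalence as EqClosure

-- Fix the target u, a standard word, and write  below k p  for the
-- subword of p formed by its letters < k.  Say p is at level k when p is standard
-- and  below k p  is a cyclic rotation of  below k u.  Every standard word is at
-- level 1 (both restrictions are the single letter 0), and a word at level N is a
-- rotation of u, hence conjugate to it.  To climb from level m+1 to m+2, write
-- p = α m β and conjugate it to  z m  with z = β α.  As m is the LAST letter,
-- the relation (c a v m, a c v m) lets every letter > m pass every letter ≤ m,
-- so  z m ≈ σ₁ B σ₂ m  for ANY factorisation σ₁ σ₂ of  below (m+1) z, where B
-- collects the letters > m of z; among these only m+1 is < m+2.  Choosing the
-- factorisation that puts m+1 where a rotation of  below (m+2) u  wants it gives
-- a word at level m+2.  Thus N conjugations lead from any standard word to u.

≈-sym : ∀ {N} {s t : Word N} → s ≈sylv t → t ≈sylv s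
≈-sym {N} = EqClosure.symmetric (SylvStep {N})

≈-reflexive : ∀ {N} {s t : Word N} → s ≡ t → s ≈sylv t
≈-reflexive refl = ε

≈-prefix : ∀ {N} (x : Word N) {s t : Word N} → s ≈sylv t → (x ++ s) ≈sylv (x ++ t)
≈-prefix x = EqClosure.gmap (x ++_) prefix-step
  where
    prefix-step : ∀ {s t} → SylvStep s t → SylvStep (x ++ s) (x ++ t)
    prefix-step (step u w v a b c a≤b b<c) =
      subst₂ SylvStep (++-assoc x u _) (++-assoc x u _) (step (x ++ u) w v a b c a≤b b<c)

-- The defining relations only reorder letters, so congruent words are permutations
-- of each other; in particular the congruence preserves standardness.
step⇒↭ : ∀ {N} {s t : Word N} → SylvStep s t → s ↭ t
step⇒↭ (step u w v a b c _ _) = ++⁺ˡ u (++⁺ʳ w (Perm.swap _ _ Perm.refl))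

≈⇒↭ : ∀ {N} {s t : Word N} → s ≈sylv t → s ↭ t
≈⇒↭ ε = Perm.refl
≈⇒↭ (fwd r ◅ rs) = ↭-trans (step⇒↭ r) (≈⇒↭ rs)
≈⇒↭ (bwd r ◅ rs) = ↭-trans (↭-sym (step⇒↭ r)) (≈⇒↭ rs)

∼-respʳ : ∀ {N} {s t t' : Word N} → s ∼ t → t' ≈sylv t → s ∼ t'
∼-respʳ (x , y , s≈xy , t≈yx) t'≈t = x , y , s≈xy , t'≈t ◅◅ t≈yx

below : ∀ {N} → ℕ → Word N → Word N
below k = filter (λ x → toℕ x <? k)

atLeast : ∀ {N} → ℕ → Word N → Word N
atLeast k = filter (λ x → k ≤? toℕ x)

exactly : ∀ {N} → ℕ → Word N → Word N
exactly k = filter (λ x → toℕ x ≟ k)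

module _ {N : ℕ} (k : ℕ) {x : Fin N} {xs : Word N} where

  below-yes : toℕ x < k → below k (x ∷ xs) ≡ x ∷ below k xs
  below-yes = filter-accept (λ y → toℕ y <? k)

  below-no : ¬ toℕ x < k → below k (x ∷ xs) ≡ below k xs
  below-no = filter-reject (λ y → toℕ y <? k)

  atLeast-yes : k ≤ toℕ x → atLeast k (x ∷ xs) ≡ x ∷ atLeast k xs
  atLeast-yes = filter-accept (λ y → k ≤? toℕ y)

  atLeast-no : ¬ k ≤ toℕ x → atLeast k (x ∷ xs) ≡ atLeast k xs
  atLeast-no = filter-reject (λ y → k ≤? toℕ y)

  exactly-yes : toℕ x ≡ k → exactly k (x ∷ xs) ≡ x ∷ exactly k xs
  exactly-yes = filter-accept (λ y → toℕ y ≟ k)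

  exactly-no : toℕ x ≢ k → exactly k (x ∷ xs) ≡ exactly k xs
  exactly-no = filter-reject (λ y → toℕ y ≟ k)

module _ {N : ℕ} (k : ℕ) where

  below-++ : (xs ys : Word N) → below k (xs ++ ys) ≡ below k xs ++ below k ys
  below-++ = filter-++ (λ y → toℕ y <? k)

  exactly-++ : (xs ys : Word N) → exactly k (xs ++ ys) ≡ exactly k xs ++ exactly k ys
  exactly-++ = filter-++ (λ y → toℕ y ≟ k)

below-zero : ∀ {N} (z : Word N) → below 0 z ≡ []
below-zero z = filter-none (λ y → toℕ y <? 0) (All.universal (λ _ ()) z)

below-all : ∀ {N} (z : Word N) → below N z ≡ z
below-all z = filter-all (λ y → toℕ y <? _) (All.universal toℕ<n z)

-- In a word ending with M, the defining relation (c a v M, a c v M) with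
-- a ≤ M < c lets a large letter c and a small letter a trade places.

module BeforeLast {N : ℕ} (M : Fin N) {m : ℕ} (M≡m : toℕ M ≡ m) where

  Small Large : Fin N → Set
  Small x = toℕ x < suc m
  Large x = suc m ≤ toℕ x

  EndsInM : Word N → Set
  EndsInM t = ∃[ v ] t ≡ v ++ [ M ]

  endsInM-++ : ∀ x {t} → EndsInM t → EndsInM (x ++ t)
  endsInM-++ x (v , refl) = x ++ v , sym (++-assoc x v [ M ])

  large-small : ∀ {a c t} → EndsInM t → Small a → Large c → (c ∷ a ∷ t) ≈sylv (a ∷ c ∷ t)
  large-small {a} {c} (v , refl) a≤m m<c =
    fwd (subst₂ SylvStep (++-identityʳ _) (++-identityʳ _)
          (step [] [] v a M c (subst (toℕ a ≤_) (sym M≡m) (ℕP.≤-pred a≤m))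
                              (subst (λ j → suc j ≤ toℕ c) (sym M≡m) m<c))) ◅ ε

  small-past-large : ∀ {a t} (B : Word N) → EndsInM t → Small a → All Large B →
                     (a ∷ B ++ t) ≈sylv (B ++ a ∷ t)
  small-past-large [] _ _ [] = ε
  small-past-large (c ∷ B) e a≤m (m<c ∷ large-B) =
    ≈-sym (large-small (endsInM-++ B e) a≤m m<c) ◅◅ ≈-prefix [ c ] (small-past-large B e a≤m large-B)

  smalls-past-large : ∀ (σ B : Word N) {t} → EndsInM t → All Small σ → All Large B →
                      (σ ++ B ++ t) ≈sylv (B ++ σ ++ t)
  smalls-past-large [] B _ [] _ = ε
  smalls-past-large (a ∷ σ) B e (a≤m ∷ small-σ) large-B =
    ≈-prefix [ a ] (smalls-past-large σ B e small-σ large-B)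
      ◅◅ small-past-large B (endsInM-++ σ e) a≤m large-B

  sort-before-M : ∀ z → (z ++ [ M ]) ≈sylv (below (suc m) z ++ atLeast (suc m) z ++ [ M ])
  sort-before-M [] = ε
  sort-before-M (x ∷ z) with toℕ x <? suc m
  ... | yes x≤m rewrite below-yes (suc m) {x} {z} x≤m | atLeast-no (suc m) {x} {z} (ℕP.<⇒≱ x≤m) =
    ≈-prefix [ x ] (sort-before-M z)
  ... | no x>m rewrite below-no (suc m) {x} {z} x>m | atLeast-yes (suc m) {x} {z} (ℕP.≮⇒≥ x>m) =
    ≈-prefix [ x ] (sort-before-M z)
      ◅◅ ≈-sym (smalls-past-large (below (suc m) z) [ x ] (atLeast (suc m) z , refl)
                  (all-filter (λ y → toℕ y <? suc m) z) (ℕP.≮⇒≥ x>m ∷ []))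

  spread-before-M : ∀ z σ₁ σ₂ → below (suc m) z ≡ σ₁ ++ σ₂ →
                    (z ++ [ M ]) ≈sylv (σ₁ ++ atLeast (suc m) z ++ σ₂ ++ [ M ])
  spread-before-M z σ₁ σ₂ split =
    sort-before-M z
      ◅◅ ≈-reflexive (cong (_++ B ++ [ M ]) split)
      ◅◅ ≈-reflexive (++-assoc σ₁ σ₂ (B ++ [ M ]))
      ◅◅ ≈-prefix σ₁ (smalls-past-large σ₂ B ([] , refl) small-σ₂ (all-filter (λ y → suc m ≤? toℕ y) z))
    where
      B = atLeast (suc m) z
      small-σ₂ : All Small σ₂
      small-σ₂ = ++⁻ʳ σ₁ (subst (All Small) split (all-filter (λ y → toℕ y <? suc m) z))

module _ {A : Set} where

  ++-equidivisible : (a b c d : List A) → a ++ b ≡ c ++ d →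
    (∃[ x ] (c ≡ a ++ x × b ≡ x ++ d)) ⊎ (∃[ x ] (a ≡ c ++ x × d ≡ x ++ b))
  ++-equidivisible [] b c d eq = inj₁ (c , refl , eq)
  ++-equidivisible (y ∷ a) b [] d eq = inj₂ (y ∷ a , refl , sym eq)
  ++-equidivisible (y ∷ a) b (y' ∷ c) d eq with ∷-injective eq
  ... | refl , eq' with ++-equidivisible a b c d eq'
  ...   | inj₁ (x , e₁ , e₂) = inj₁ (x , cong (y ∷_) e₁ , e₂)
  ...   | inj₂ (x , e₁ , e₂) = inj₂ (x , cong (y ∷_) e₁ , e₂)

  Rot : List A → List A → Set
  Rot a b = ∃[ x ] ∃[ y ] (a ≡ x ++ y × b ≡ y ++ x)

  rot-refl : ∀ a → Rot a a
  rot-refl a = a , [] , sym (++-identityʳ a) , refl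

  rot-swap : ∀ x y → Rot (x ++ y) (y ++ x)
  rot-swap x y = x , y , refl , refl

  rot-trans : ∀ {a b c} → Rot a b → Rot b c → Rot a c
  rot-trans (x₁ , y₁ , refl , b≡y₁x₁) (x₂ , y₂ , b≡x₂y₂ , refl)
    with ++-equidivisible y₁ x₁ x₂ y₂ (trans (sym b≡y₁x₁) b≡x₂y₂)
  ... | inj₁ (x , refl , refl) = x , y₂ ++ y₁ , ++-assoc x y₂ y₁ , sym (++-assoc y₂ y₁ x)
  ... | inj₂ (x , refl , refl) = x₁ ++ x₂ , x , sym (++-assoc x₁ x₂ x) , ++-assoc x x₁ x₂

  rot-insert : ∀ (w : List A) (M K : A) {L} → Rot (w ++ [ M ]) L →
    ∃[ σ₁ ] ∃[ σ₂ ] (w ≡ σ₁ ++ σ₂ × Rot (σ₁ ++ K ∷ σ₂ ++ [ M ]) (K ∷ L))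
  rot-insert w M K (x , y , wM≡xy , refl) with ++-equidivisible w [ M ] x y wM≡xy
  ... | inj₂ (σ₂ , refl , refl) = x , σ₂ , refl , x , K ∷ σ₂ ++ [ M ] , refl , refl
  ... | inj₁ ([] , refl , refl) =
    w , [] , sym (++-identityʳ w) , w , K ∷ M ∷ [] , refl , cong (λ v → K ∷ M ∷ v) (++-identityʳ w)
  ... | inj₁ (M' ∷ x' , refl , e) with ∷-injective e
  ...   | refl , []≡x'y rewrite ++-conicalˡ x' y (sym []≡x'y) | ++-conicalʳ x' y (sym []≡x'y) =
    [] , w , refl , rot-refl _

module _ {N : ℕ} where

  exactly-tabulate-below : ∀ n (f : Fin n → Fin N) c → (∀ i → toℕ (f i) ≡ c + toℕ i) →
                           ∀ j → j < c → exactly j (tabulate f) ≡ []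
  exactly-tabulate-below ℕ.zero f c f≡ j j<c = refl
  exactly-tabulate-below (suc n) f c f≡ j j<c =
    trans (exactly-no j (λ f0≡j → ℕP.<⇒≢ j<c (trans (sym f0≡j) (trans (f≡ zero) (ℕP.+-identityʳ c)))))
          (exactly-tabulate-below n (λ i → f (suc i)) (suc c)
             (λ i → trans (f≡ (suc i)) (ℕP.+-suc c (toℕ i))) j (ℕP.m<n⇒m<1+n j<c))

  exactly-tabulate : ∀ n (f : Fin n → Fin N) c → (∀ i → toℕ (f i) ≡ c + toℕ i) →
                     ∀ k (k<n : k < n) → exactly (c + k) (tabulate f) ≡ [ f (fromℕ< k<n) ]
  exactly-tabulate (suc n) f c f≡ ℕ.zero k<n =
    trans (exactly-yes (c + 0) (f≡ zero))
          (cong (f zero ∷_) (exactly-tabulate-below n (λ i → f (suc i)) (suc c)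
                               (λ i → trans (f≡ (suc i)) (ℕP.+-suc c (toℕ i)))
                               (c + 0) (s≤s (ℕP.≤-reflexive (ℕP.+-identityʳ c)))))
  exactly-tabulate (suc n) f c f≡ (suc k) k<n =
    trans (exactly-no (c + suc k) (λ f0≡ → 0≢1+ (ℕP.+-cancelˡ-≡ c 0 (suc k) (trans (sym (f≡ zero)) f0≡))))
          (subst (λ j → exactly j (tabulate (λ i → f (suc i))) ≡ [ f (fromℕ< k<n) ]) (sym (ℕP.+-suc c k))
                 (exactly-tabulate n (λ i → f (suc i)) (suc c)
                    (λ i → trans (f≡ (suc i)) (ℕP.+-suc c (toℕ i))) k (ℕP.≤-pred k<n)))
    where
      0≢1+ : ∀ {j} → 0 ≢ suc j
      0≢1+ ()

  exactly-standard : ∀ {p : Word N} → p ↭ allFin N → ∀ k (k<N : k < N) → exactly k p ≡ [ fromℕ< k<N ]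
  exactly-standard {p} p-std k k<N =
    ↭-singleton-inv (subst (exactly k p ↭_) (exactly-tabulate N (λ i → i) 0 (λ i → refl) k k<N)
                           (filter-↭ (λ y → toℕ y ≟ k) p-std))

  below-suc-absent : ∀ k (z : Word N) → exactly k z ≡ [] → below (suc k) z ≡ below k z
  below-suc-absent k [] _ = refl
  below-suc-absent k (x ∷ z) none with ℕP.<-cmp (toℕ x) k
  ... | tri< x<k _ _ =
    trans (below-yes (suc k) (ℕP.m<n⇒m<1+n x<k))
          (trans (cong (x ∷_) (below-suc-absent k z (trans (sym (exactly-no k (ℕP.<⇒≢ x<k))) none)))
                 (sym (below-yes k x<k)))
  ... | tri≈ _ x≡k _ with () ← trans (sym (exactly-yes k x≡k)) none
  ... | tri> _ _ x>k =
    trans (below-no (suc k) (λ x≤k → ℕP.<⇒≱ x>k (ℕP.≤-pred x≤k)))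
          (trans (below-suc-absent k z (trans (sym (exactly-no k (ℕP.>⇒≢ x>k))) none))
                 (sym (below-no k (ℕP.<-asym x>k))))

  below-suc-split : ∀ k (K : Fin N) (z : Word N) → exactly k z ≡ [ K ] →
    ∃[ L₁ ] ∃[ L₂ ] (below (suc k) z ≡ L₁ ++ K ∷ L₂ × below k z ≡ L₁ ++ L₂)
  below-suc-split k K (x ∷ z) once with ℕP.<-cmp (toℕ x) k
  ... | tri< x<k _ _ with below-suc-split k K z (trans (sym (exactly-no k (ℕP.<⇒≢ x<k))) once)
  ...   | L₁ , L₂ , e₁ , e₀ =
    x ∷ L₁ , L₂ , trans (below-yes (suc k) (ℕP.m<n⇒m<1+n x<k)) (cong (x ∷_) e₁)
               , trans (below-yes k x<k) (cong (x ∷_) e₀)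
  below-suc-split k K (x ∷ z) once | tri≈ _ x≡k _ with ∷-injective (trans (sym (exactly-yes k x≡k)) once)
  ...   | refl , none =
    [] , below k z , trans (below-yes (suc k) (s≤s (ℕP.≤-reflexive x≡k))) (cong (x ∷_) (below-suc-absent k z none))
                   , below-no k (ℕP.<-irrefl x≡k)
  below-suc-split k K (x ∷ z) once | tri> _ _ x>k
    with below-suc-split k K z (trans (sym (exactly-no k (ℕP.>⇒≢ x>k))) once)
  ...   | L₁ , L₂ , e₁ , e₀ =
    L₁ , L₂ , trans (below-no (suc k) (λ x≤k → ℕP.<⇒≱ x>k (ℕP.≤-pred x≤k))) e₁
           , trans (below-no k (ℕP.<-asym x>k)) e₀

  below-atLeast : ∀ k (z : Word N) → below (suc k) (atLeast k z) ≡ exactly k z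
  below-atLeast k [] = refl
  below-atLeast k (x ∷ z) with ℕP.<-cmp (toℕ x) k
  ... | tri< x<k _ _ =
    trans (cong (below (suc k)) (atLeast-no k (ℕP.<⇒≱ x<k)))
          (trans (below-atLeast k z) (sym (exactly-no k (ℕP.<⇒≢ x<k))))
  ... | tri≈ _ x≡k _ =
    trans (cong (below (suc k)) (atLeast-yes k (ℕP.≤-reflexive (sym x≡k))))
          (trans (below-yes (suc k) (s≤s (ℕP.≤-reflexive x≡k)))
                 (trans (cong (x ∷_) (below-atLeast k z)) (sym (exactly-yes k x≡k))))
  ... | tri> _ _ x>k =
    trans (cong (below (suc k)) (atLeast-yes k (ℕP.<⇒≤ x>k)))
          (trans (below-no (suc k) (λ x≤k → ℕP.<⇒≱ x>k (ℕP.≤-pred x≤k)))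
                 (trans (below-atLeast k z) (sym (exactly-no k (ℕP.>⇒≢ x>k)))))

below-one-standard : ∀ {N} {z : Word (suc N)} → z ↭ allFin (suc N) → below 1 z ≡ [ zero ]
below-one-standard {z = z} z-std with below-suc-split 0 zero z (exactly-standard z-std 0 (s≤s z≤n))
... | L₁ , L₂ , e₁ , e₀ rewrite ++-conicalˡ L₁ L₂ (trans (sym e₀) (below-zero z))
                              | ++-conicalʳ L₁ L₂ (trans (sym e₀) (below-zero z)) = e₁

∼⇒↭ : ∀ {N} {s t : Word N} → s ∼ t → s ↭ t
∼⇒↭ (x , y , s≈xy , t≈yx) = ↭-trans (≈⇒↭ s≈xy) (↭-trans (++-comm x y) (↭-sym (≈⇒↭ t≈yx)))

below-conjugate : ∀ {N} k {M : Fin N} → toℕ M < k → ∀ α β →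
                  Rot (below k (β ++ α) ++ [ M ]) (below k (α ++ M ∷ β))
below-conjugate k {M} M<k α β =
  subst₂ Rot (cong (_++ [ M ]) (sym (below-++ k β α)))
             (sym (trans (below-++ k α (M ∷ β)) (cong (below k α ++_) (below-yes k M<k))))
             (below k β , below k α ++ [ M ] , ++-assoc (below k β) (below k α) [ M ]
                        , sym (++-assoc (below k α) [ M ] (below k β)))

++-singleton-comm : ∀ {A : Set} {K : A} (a b : List A) → a ++ b ≡ [ K ] → b ++ a ≡ [ K ]
++-singleton-comm [] b e = trans (++-identityʳ b) e
++-singleton-comm (x ∷ []) [] e = e

exactly-conjugate : ∀ {N} k {M K : Fin N} → toℕ M ≢ k → ∀ α β →
                    exactly k (α ++ M ∷ β) ≡ [ K ] → exactly k (β ++ α) ≡ [ K ]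
exactly-conjugate k {M} M≢k α β once =
  trans (exactly-++ k β α)
        (++-singleton-comm (exactly k α) (exactly k β)
           (trans (sym (trans (exactly-++ k α (M ∷ β)) (cong (exactly k α ++_) (exactly-no k M≢k)))) once))

below-spread : ∀ {N} k {M K : Fin N} (z σ₁ σ₂ : Word N) → below k z ≡ σ₁ ++ σ₂ →
               exactly k z ≡ [ K ] → toℕ M < k →
               below (suc k) (σ₁ ++ atLeast k z ++ σ₂ ++ [ M ]) ≡ σ₁ ++ K ∷ σ₂ ++ [ M ]
below-spread k {M} {K} z σ₁ σ₂ split once M<k = begin
  below (suc k) (σ₁ ++ atLeast k z ++ σ₂ ++ [ M ])
    ≡⟨ below-++ (suc k) σ₁ _ ⟩
  below (suc k) σ₁ ++ below (suc k) (atLeast k z ++ σ₂ ++ [ M ])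
    ≡⟨ cong (below (suc k) σ₁ ++_) (below-++ (suc k) (atLeast k z) _) ⟩
  below (suc k) σ₁ ++ below (suc k) (atLeast k z) ++ below (suc k) (σ₂ ++ [ M ])
    ≡⟨ cong₂ _++_ (unchanged (++⁻ˡ σ₁ small-σ))
                  (cong₂ _++_ (trans (below-atLeast k z) once)
                              (unchanged (++⁺ (++⁻ʳ σ₁ small-σ) (M<k ∷ [])))) ⟩
  σ₁ ++ K ∷ σ₂ ++ [ M ] ∎
  where
    open ≡-Reasoning
    small-σ : All (λ y → toℕ y < k) (σ₁ ++ σ₂)
    small-σ = subst (All (λ y → toℕ y < k)) split (all-filter (λ y → toℕ y <? k) z)
    unchanged : ∀ {xs} → All (λ y → toℕ y < k) xs → below (suc k) xs ≡ xs
    unchanged small = filter-all (λ y → toℕ y <? suc k) (All.map ℕP.m<n⇒m<1+n small)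

Chain : ∀ {N} → Word N → Word N → ℕ → Set
Chain {N} s t d = Σ (Fin (suc d) → Word N) λ Ts →
  (Ts zero ≈sylv s) × (Ts (fromℕ d) ≈sylv t) × ((h : Fin d) → Ts (inject₁ h) ∼ Ts (suc h))

chain-nil : ∀ {N} {s t : Word N} → s ≈sylv t → Chain s t 0
chain-nil {s = s} s≈t = (λ _ → s) , ε , s≈t , λ ()

chain-cons : ∀ {N d} {s s' t : Word N} → s ∼ s' → Chain s' t d → Chain s t (suc d)
chain-cons {s = s} s∼s' (Ts , start , end , links) = Ts' , ε , end , links'
  where
    Ts' : Fin _ → Word _
    Ts' zero = s
    Ts' (suc i) = Ts i
    links' : ∀ h → Ts' (inject₁ h) ∼ Ts' (suc h)
    links' zero = ∼-respʳ s∼s' start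
    links' (suc h) = links h

chain-resp : ∀ {N d} {s s' t t' : Word N} → s' ≈sylv s → t ≈sylv t' → Chain s t d → Chain s' t' d
chain-resp s'≈s t≈t' (Ts , start , end , links) = Ts , start ◅◅ ≈-sym s'≈s , end ◅◅ t≈t' , links

module Climb {N : ℕ} (u : Word N) (u-std : u ↭ allFin N) where

  AtLevel : ℕ → Word N → Set
  AtLevel k p = (p ↭ allFin N) × Rot (below k p) (below k u)

  rot-insert-level : ∀ k (k<N : k < N) w M → Rot (w ++ [ M ]) (below k u) →
    ∃[ σ₁ ] ∃[ σ₂ ] (w ≡ σ₁ ++ σ₂ × Rot (σ₁ ++ fromℕ< k<N ∷ σ₂ ++ [ M ]) (below (suc k) u))
  rot-insert-level k k<N w M R
    with below-suc-split k (fromℕ< k<N) u (exactly-standard u-std k k<N)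
  ... | L₁ , L₂ , u₁ , u₀
    with rot-insert w M (fromℕ< k<N) (rot-trans R (subst (λ q → Rot q (L₂ ++ L₁)) (sym u₀) (rot-swap L₁ L₂)))
  ... | σ₁ , σ₂ , w≡σ₁σ₂ , R' =
    σ₁ , σ₂ , w≡σ₁σ₂ , rot-trans R' (subst (Rot _) (sym u₁) (rot-swap (fromℕ< k<N ∷ L₂) L₁))

  module Step (m : ℕ) (m+1<N : suc m < N) where

    m<N : m < N
    m<N = ℕP.<⇒≤ m+1<N

    M : Fin N
    M = fromℕ< m<N

    open BeforeLast M (toℕ-fromℕ< m<N)

    M<m+1 : toℕ M < suc m
    M<m+1 = s≤s (ℕP.≤-reflexive (toℕ-fromℕ< m<N))

    climb-at : ∀ α β → AtLevel (suc m) (α ++ M ∷ β) →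
               ∃[ p' ] (AtLevel (suc (suc m)) p' × (α ++ M ∷ β) ∼ p')
    climb-at α β (p-std , R)
      with rot-insert-level (suc m) m+1<N (below (suc m) (β ++ α)) M
             (rot-trans (below-conjugate (suc m) M<m+1 α β) R)
    ... | σ₁ , σ₂ , split , R' = p' , (p'-std , R'') , p∼p'
      where
        z = β ++ α
        p' = σ₁ ++ atLeast (suc m) z ++ σ₂ ++ [ M ]
        p∼p' : (α ++ M ∷ β) ∼ p'
        p∼p' = α ++ [ M ] , β , ≈-reflexive (sym (++-assoc α [ M ] β))
             , ≈-sym (≈-reflexive (sym (++-assoc β α [ M ])) ◅◅ spread-before-M z σ₁ σ₂ split)
        p'-std : p' ↭ allFin N
        p'-std = ↭-trans (↭-sym (∼⇒↭ p∼p')) p-std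
        z-once : exactly (suc m) z ≡ [ fromℕ< m+1<N ]
        z-once = exactly-conjugate (suc m) (ℕP.<⇒≢ M<m+1) α β (exactly-standard p-std (suc m) m+1<N)
        R'' : Rot (below (suc (suc m)) p') (below (suc (suc m)) u)
        R'' = subst (λ q → Rot q _) (sym (below-spread (suc m) z σ₁ σ₂ split z-once M<m+1)) R'

    climb : ∀ p → AtLevel (suc m) p → ∃[ p' ] (AtLevel (suc (suc m)) p' × p ∼ p')
    climb p (p-std , R) with ∈-∃++ (∈-resp-↭ (↭-sym p-std) (∈-allFin M))
    ... | α , β , refl = climb-at α β (p-std , R)

  climb-to-top : ∀ d m → suc m + d ≡ N → ∀ p → AtLevel (suc m) p → Chain p u (suc d)
  climb-to-top ℕ.zero m m+1≡N p (_ , R) = chain-cons p∼u (chain-nil ε)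
    where
      everything-below : ∀ z → below (suc m) z ≡ z
      everything-below z = subst (λ k → below k z ≡ z) (trans (sym m+1≡N) (ℕP.+-identityʳ (suc m))) (below-all z)
      p∼u : p ∼ u
      p∼u with subst₂ Rot (everything-below p) (everything-below u) R
      ... | x , y , p≡xy , u≡yx = x , y , ≈-reflexive p≡xy , ≈-reflexive u≡yx
  climb-to-top (suc d) m m+1+d+1≡N p at-level
    with Step.climb m (subst (suc (suc m) ≤_) m+2+d≡N (ℕP.m≤m+n (suc (suc m)) d)) p at-level
    where
      m+2+d≡N : suc (suc m) + d ≡ N
      m+2+d≡N = trans (sym (ℕP.+-suc (suc m) d)) m+1+d+1≡N
  ... | p' , at-level' , p∼p' =
    chain-cons p∼p' (climb-to-top d (suc m) (trans (sym (ℕP.+-suc (suc m) d)) m+1+d+1≡N) p' at-level')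

standard-chain : ∀ n {w u : Word n} → w ↭ allFin n → u ↭ allFin n → Chain w u n
standard-chain ℕ.zero w-std u-std = chain-nil (≈-reflexive (trans (↭-empty-inv w-std) (sym (↭-empty-inv u-std))))
standard-chain (suc n) {w} {u} w-std u-std =
  Climb.climb-to-top u u-std n 0 refl w
    (w-std , subst₂ Rot (sym (below-one-standard w-std)) (sym (below-one-standard u-std)) (rot-refl [ zero ]))

lemma4p3 : (n : ℕ) (T U : Word n) → Standard n T → Standard n U →
    Σ (Fin (suc n) → Word n) λ Ts → ((Ts zero ≈sylv T) × (Ts (fromℕ n) ≈sylv U) ×
    ((h : Fin n) → Ts (inject₁ h) ∼ Ts (suc h)))
lemma4p3 n T U (w , w≈T , w-std) (u , u≈U , u-std) =
  chain-resp (≈-sym w≈T) u≈U (standard-chain n w-std u-std)
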